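{- For every $n$-vertex graph $G$ and every integer $k$ with $\mu(G)\geq k > 0$, we have $\operatorname{av}_k(K_n)\geq \operatorname{av}_k(G)$, with equality if and only if $G$ is a complete graph.
   Context: A matching of a graph is a set of pairwise vertex-disjoint edges; $m(G,k)$ denotes the number of matchings of cardinality $k$ in $G$ and $\mu(G)$ the matching number of $G$. For a nonnegative integer $k$, let $M_k(G)=\sum_{i=0}^k m(G,i)$, $S_k(G)=\sum_{i=0}^k i\,m(G,i)$ and $\operatorname{av}_k(G)=S_k(G)/M_k(G)$ (the average size of matchings of size at most $k$). $K_n$ is the complete graph on $n$ vertices. -}

module Defs where

open import Data.Bool using (Bool; true; false; _∧_; not)
open import Data.Nat using (ℕ; zero; suc; _+_; _*_; _⊔_; _≡ᵇ_)
open import Data.Fin using (Fin; toℕ)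
open import Data.Fin.Properties using (_≟_)
open import Data.List using (List; []; _∷_; map; _++_; length; filterᵇ; cartesianProduct; allFin; upTo; foldr)
open import Data.Nat.ListAction using (sum)
open import Data.Bool.ListAction using (all)
open import Data.Product using (_×_; _,_)
open import Data.Integer using (+_)
open import Data.Rational using (ℚ; _/_; 0ℚ)
open import Relation.Nullary.Decidable using (⌊_⌋)
open import Relation.Binary.PropositionalEquality using (_≡_; _≢_)

record Graph (n : ℕ) : Set where
  field
    adj   : Fin n → Fin n → Bool
    adj-sym    : ∀ i j → adj i j ≡ adj j i
    adj-irrefl : ∀ i → adj i i ≡ false
open Graph public

edges : ∀ {n} → Graph n → List (Fin n × Fin n)
edges {n} G = filterᵇ (λ { (i , j) → (suc (toℕ i) Data.Nat.≤ᵇ toℕ j) ∧ adj G i j })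
                      (cartesianProduct (allFin n) (allFin n))

sublists : ∀ {A : Set} → List A → List (List A)
sublists [] = [] ∷ []
sublists (x ∷ xs) = map (x ∷_) (sublists xs) ++ sublists xs

_≠ᵇ_ : ∀ {n} → Fin n → Fin n → Bool
a ≠ᵇ b = not ⌊ a ≟ b ⌋

disjoint : ∀ {n} → Fin n × Fin n → Fin n × Fin n → Bool
disjoint (a , b) (c , d) = (a ≠ᵇ c) ∧ (a ≠ᵇ d) ∧ (b ≠ᵇ c) ∧ (b ≠ᵇ d)

isMatching : ∀ {n} → List (Fin n × Fin n) → Bool
isMatching [] = true
isMatching (e ∷ es) = all (disjoint e) es ∧ isMatching es

matchings : ∀ {n} → Graph n → List (List (Fin n × Fin n))
matchings G = filterᵇ isMatching (sublists (edges G))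

m : ∀ {n} → Graph n → ℕ → ℕ
m G i = length (filterᵇ (λ s → length s ≡ᵇ i) (matchings G))

μ : ∀ {n} → Graph n → ℕ
μ G = foldr _⊔_ 0 (map length (matchings G))

M : ∀ {n} → Graph n → ℕ → ℕ
M G k = sum (map (m G) (upTo (suc k)))

S : ∀ {n} → Graph n → ℕ → ℕ
S G k = sum (map (λ i → i * m G i) (upTo (suc k)))

-- av_k(G) = S_k(G) / M_k(G). (M_k(G) ≥ 1 always, as the empty matching counts;
-- the zero branch is never reached.)
av : ∀ {n} → Graph n → ℕ → ℚ
av G k with M G k
... | zero  = 0ℚ
... | suc d = (+ S G k) / suc d

K : (n : ℕ) → Graph n
K n = record { adj = λ i j → i ≠ᵇ j ; adj-sym = symm ; adj-irrefl = irr }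
  where
  open import Relation.Binary.PropositionalEquality using (refl; sym)
  open import Relation.Nullary using (yes; no)
  open import Data.Empty using (⊥-elim)
  symm : ∀ i j → (i ≠ᵇ j) ≡ (j ≠ᵇ i)
  symm i j with i ≟ j | j ≟ i
  ... | yes _ | yes _ = refl
  ... | no _  | no _  = refl
  ... | yes p | no q  = ⊥-elim (q (sym p))
  ... | no p  | yes q = ⊥-elim (p (sym q))
  irr : ∀ i → (i ≠ᵇ i) ≡ false
  irr i with i ≟ i
  ... | yes _ = refl
  ... | no q  = ⊥-elim (q refl)

IsComplete : ∀ {n} → Graph n → Set
IsComplete {n} G = ∀ (i j : Fin n) → i ≢ j → adj G i j ≡ true

-- Counting pairs (matching of size l, edge disjoint from it) shows that (l+1)·m(G,l+1) is the sum,
-- over the l-matchings t of G, of the number of edges of G avoiding all vertices of t. Such a t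
-- leaves n − 2l vertices uncovered, so in K_n this number is C(n−2l, 2) for every t, and in G it is
-- at most that. Hence m(G,l+1)·m(K_n,l) ≤ m(G,l)·m(K_n,l+1), and m(G,l) > 0 for l ≤ μ(G).
-- Cross-multiplying the two averages, the pair of indices i < j contributes
-- (j − i)(m(G,j)·m(K_n,i) − m(K_n,j)·m(G,i)) ≤ 0 to S_k(G)·M_k(K_n) − S_k(K_n)·M_k(G).
-- A missing edge gives m(G,1) < m(K_n,1), so the pair (0,1) makes the inequality strict.

module Submission where

open import Defs
open import Data.Bool using (Bool; true; false; _∧_; T; T?)
open import Data.Bool.Properties using (∧-comm; ∧-assoc; ∧-zeroʳ; T-≡; T-∧)
open import Data.Bool.ListAction using (all)
open import Data.Nat
  using (ℕ; zero; suc; _+_; _*_; _∸_; _⊔_; _≤_; _<_; _≤′_; z≤n; s≤s; z<s; ≤′-refl; ≤′-step; _≡ᵇ_; _<ᵇ_; _≤?_; >-nonZero)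
open import Data.Nat.Properties hiding (_≟_)
open import Data.Nat.Combinatorics using (_C_; nC1≡n; nCk+nC[k+1]≡[n+1]C[k+1])
open import Data.Nat.Tactic.RingSolver using (solve-∀)
open import Data.Nat.ListAction using (sum)
open import Data.Nat.ListAction.Properties using (sum-++)
open import Data.List
  using (List; []; _∷_; [_]; map; _++_; length; filterᵇ; upTo; applyUpTo; tabulate; cartesianProduct; allFin)
open import Data.List.Properties
  using (map-++; map-∘; map-cong; length-map; length-++; filter-++; filter-all; foldr-preservesᵇ)
open import Data.List.Relation.Unary.All as All using (All; []; _∷_)
open import Data.List.Relation.Unary.All.Properties using (map⁺; all-filter; filter⁺; all⁺)
open import Data.Fin using (Fin; toℕ; zero; suc)
open import Data.Fin.Properties using (_≟_; toℕ-injective)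
open import Data.Integer using (+≤+) renaming (+_ to ℤ+_; _≤_ to _≤ℤ_)
import Data.Integer.Properties as ℤ
open import Data.Rational using (_/_; toℚᵘ) renaming (_≤_ to _≤ℚ_)
import Data.Rational.Properties as ℚ
open import Data.Rational.Unnormalised using (mkℚᵘ; *≤*; *≡*)
import Data.Rational.Unnormalised.Properties as ℚᵘ
open import Data.Product using (_×_; _,_; proj₁; proj₂; map₁)
open import Data.Sum using (inj₁; inj₂)
open import Function using (_∘_; id)
open import Relation.Binary.PropositionalEquality hiding ([_])
open import Relation.Nullary using (yes; no; contradiction)
open import Relation.Binary using (tri<; tri≈; tri>)
open import Function.Bundles using (_⇔_; mk⇔; Equivalence)
open import Algebra.Properties.CommutativeSemigroup +-commutativeSemigroup
  using () renaming (interchange to +-interchange)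

private variable
  A B : Set

bool→ℕ : Bool → ℕ
bool→ℕ true  = 1
bool→ℕ false = 0

module _ (p : A → Bool) where

  filterᵇ-++ : ∀ xs ys → filterᵇ p (xs ++ ys) ≡ filterᵇ p xs ++ filterᵇ p ys
  filterᵇ-++ = filter-++ (T? ∘ p)

  length-filterᵇ-∷ : ∀ x xs → length (filterᵇ p (x ∷ xs)) ≡ bool→ℕ (p x) + length (filterᵇ p xs)
  length-filterᵇ-∷ x xs with p x
  ... | true  = refl
  ... | false = refl

  filterᵇ-map : ∀ (f : B → A) xs → filterᵇ p (map f xs) ≡ map f (filterᵇ (p ∘ f) xs)
  filterᵇ-map f [] = refl
  filterᵇ-map f (x ∷ xs) with p (f x)
  ... | true  = cong (f x ∷_) (filterᵇ-map f xs)
  ... | false = filterᵇ-map f xs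

  filterᵇ-filterᵇ : ∀ q xs → filterᵇ p (filterᵇ q xs) ≡ filterᵇ (λ x → q x ∧ p x) xs
  filterᵇ-filterᵇ q [] = refl
  filterᵇ-filterᵇ q (x ∷ xs) with q x
  ... | false = filterᵇ-filterᵇ q xs
  ... | true with p x
  ...   | true  = cong (x ∷_) (filterᵇ-filterᵇ q xs)
  ...   | false = filterᵇ-filterᵇ q xs

  sum-map-bool→ℕ : ∀ xs → sum (map (bool→ℕ ∘ p) xs) ≡ length (filterᵇ p xs)
  sum-map-bool→ℕ [] = refl
  sum-map-bool→ℕ (x ∷ xs) =
    trans (cong (bool→ℕ (p x) +_) (sum-map-bool→ℕ xs)) (sym (length-filterᵇ-∷ x xs))

filterᵇ-cong : ∀ {p q : A → Bool} → (∀ x → p x ≡ q x) → ∀ xs → filterᵇ p xs ≡ filterᵇ q xs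
filterᵇ-cong p≗q [] = refl
filterᵇ-cong {p = p} {q} p≗q (x ∷ xs) with p x | q x | p≗q x
... | true  | .true  | refl = cong (x ∷_) (filterᵇ-cong p≗q xs)
... | false | .false | refl = filterᵇ-cong p≗q xs

filterᵇ-comm : ∀ (p q : A → Bool) xs → filterᵇ p (filterᵇ q xs) ≡ filterᵇ q (filterᵇ p xs)
filterᵇ-comm p q xs = begin
  filterᵇ p (filterᵇ q xs)        ≡⟨ filterᵇ-filterᵇ p q xs ⟩
  filterᵇ (λ x → q x ∧ p x) xs    ≡⟨ filterᵇ-cong (λ x → ∧-comm (q x) (p x)) xs ⟩
  filterᵇ (λ x → p x ∧ q x) xs    ≡⟨ filterᵇ-filterᵇ q p xs ⟨
  filterᵇ q (filterᵇ p xs)        ∎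
  where open ≡-Reasoning

length-filterᵇ-mono : ∀ {p q : A → Bool} → (∀ x → T (p x) → T (q x)) → ∀ xs →
  length (filterᵇ p xs) ≤ length (filterᵇ q xs)
length-filterᵇ-mono p⇒q [] = z≤n
length-filterᵇ-mono {p = p} {q} p⇒q (x ∷ xs) with p x | q x | p⇒q x
... | true  | true  | _  = s≤s (length-filterᵇ-mono p⇒q xs)
... | true  | false | pq with () ← pq _
... | false | true  | _  = m≤n⇒m≤1+n (length-filterᵇ-mono p⇒q xs)
... | false | false | _  = length-filterᵇ-mono p⇒q xs

filterᵇ-const-true : ∀ (xs : List A) → filterᵇ (λ _ → true) xs ≡ xs
filterᵇ-const-true xs = filter-all (T? ∘ (λ _ → true)) (All.universal _ xs)

sum-map-++ : ∀ (f : A → ℕ) xs ys → sum (map f (xs ++ ys)) ≡ sum (map f xs) + sum (map f ys)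
sum-map-++ f xs ys = trans (cong sum (map-++ f xs ys)) (sum-++ (map f xs) (map f ys))

sum-map-+ : ∀ (f g : A → ℕ) xs → sum (map (λ x → f x + g x) xs) ≡ sum (map f xs) + sum (map g xs)
sum-map-+ f g [] = refl
sum-map-+ f g (x ∷ xs) =
  trans (cong (f x + g x +_) (sum-map-+ f g xs)) (+-interchange (f x) (g x) _ _)

sum-map-∘ : ∀ (f : B → ℕ) (g : A → B) xs → sum (map f (map g xs)) ≡ sum (map (f ∘ g) xs)
sum-map-∘ f g xs = cong sum (sym (map-∘ xs))

sum-map-≤ : ∀ (f : A → ℕ) {D xs} → All (λ x → f x ≤ D) xs → sum (map f xs) ≤ length xs * D
sum-map-≤ f []           = z≤n
sum-map-≤ f (fx≤D ∷ f≤D) = +-mono-≤ fx≤D (sum-map-≤ f f≤D)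

sum-map-≡ : ∀ (f : A → ℕ) {D xs} → All (λ x → f x ≡ D) xs → sum (map f xs) ≡ length xs * D
sum-map-≡ f []           = refl
sum-map-≡ f (fx≡D ∷ f≡D) = cong₂ _+_ fx≡D (sum-map-≡ f f≡D)

sublists-filterᵇ : ∀ (p : A → Bool) xs → filterᵇ (all p) (sublists xs) ≡ sublists (filterᵇ p xs)
sublists-filterᵇ p [] = refl
sublists-filterᵇ p (x ∷ xs) with p x in px
... | true = begin
  filterᵇ (all p) (map (x ∷_) subs ++ subs)
    ≡⟨ filterᵇ-++ (all p) (map (x ∷_) subs) subs ⟩
  filterᵇ (all p) (map (x ∷_) subs) ++ filterᵇ (all p) subs
    ≡⟨ cong₂ _++_ (filterᵇ-map (all p) (x ∷_) subs) (sublists-filterᵇ p xs) ⟩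
  map (x ∷_) (filterᵇ (λ s → p x ∧ all p s) subs) ++ sublists (filterᵇ p xs)
    ≡⟨ cong (λ ys → map (x ∷_) ys ++ sublists (filterᵇ p xs))
            (trans (filterᵇ-cong (λ s → cong (_∧ all p s) px) subs) (sublists-filterᵇ p xs)) ⟩
  map (x ∷_) (sublists (filterᵇ p xs)) ++ sublists (filterᵇ p xs) ∎
  where
  open ≡-Reasoning
  subs = sublists xs
... | false = begin
  filterᵇ (all p) (map (x ∷_) subs ++ subs)
    ≡⟨ filterᵇ-++ (all p) (map (x ∷_) subs) subs ⟩
  filterᵇ (all p) (map (x ∷_) subs) ++ filterᵇ (all p) subs
    ≡⟨ cong₂ _++_ (rejected subs) (sublists-filterᵇ p xs) ⟩
  sublists (filterᵇ p xs) ∎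
  where
  open ≡-Reasoning
  subs = sublists xs
  rejected : ∀ ys → filterᵇ (all p) (map (x ∷_) ys) ≡ []
  rejected [] = refl
  rejected (_ ∷ ys) rewrite px = rejected ys

-- Averages of sequences with dominated ratios

sumBelow : ℕ → (ℕ → ℕ) → ℕ
sumBelow zero    f = 0
sumBelow (suc j) f = sumBelow j f + f j

sumBelow-mono-≤ : ∀ j {f g : ℕ → ℕ} → (∀ i → i < j → f i ≤ g i) → sumBelow j f ≤ sumBelow j g
sumBelow-mono-≤ zero    f≤g = z≤n
sumBelow-mono-≤ (suc j) f≤g =
  +-mono-≤ (sumBelow-mono-≤ j (λ i i<j → f≤g i (m<n⇒m<1+n i<j))) (f≤g j (n<1+n j))

sumBelow-+ : ∀ j (f g : ℕ → ℕ) → sumBelow j (λ i → f i + g i) ≡ sumBelow j f + sumBelow j g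
sumBelow-+ zero    f g = refl
sumBelow-+ (suc j) f g = trans (cong (_+ (f j + g j)) (sumBelow-+ j f g))
  (+-interchange (sumBelow j f) (sumBelow j g) (f j) (g j))

sumBelow-*ʳ : ∀ j (f : ℕ → ℕ) c → sumBelow j f * c ≡ sumBelow j (λ i → f i * c)
sumBelow-*ʳ zero    f c = refl
sumBelow-*ʳ (suc j) f c = trans (*-distribʳ-+ c (sumBelow j f) (f j)) (cong (_+ f j * c) (sumBelow-*ʳ j f c))

sumBelow-*ˡ : ∀ j (f : ℕ → ℕ) c → c * sumBelow j f ≡ sumBelow j (λ i → c * f i)
sumBelow-*ˡ zero    f c = *-zeroʳ c
sumBelow-*ˡ (suc j) f c = trans (*-distribˡ-+ c (sumBelow j f) (f j)) (cong (_+ c * f j) (sumBelow-*ˡ j f c))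

sumBelow-suc : ∀ j (f : ℕ → ℕ) → sumBelow (suc j) f ≡ f 0 + sumBelow j (f ∘ suc)
sumBelow-suc zero    f = +-comm 0 (f 0)
sumBelow-suc (suc j) f = trans (cong (_+ f (suc j)) (sumBelow-suc j f)) (+-assoc (f 0) _ _)

sum-map-applyUpTo : ∀ (f g : ℕ → ℕ) j → sum (map f (applyUpTo g j)) ≡ sumBelow j (f ∘ g)
sum-map-applyUpTo f g zero    = refl
sum-map-applyUpTo f g (suc j) =
  trans (cong (f (g 0) +_) (sum-map-applyUpTo f (g ∘ suc) j)) (sym (sumBelow-suc j (f ∘ g)))

sum-map-upTo : ∀ (f : ℕ → ℕ) j → sum (map f (upTo j)) ≡ sumBelow j f
sum-map-upTo f = sum-map-applyUpTo f id

-- With j = i + r the two sides differ by r (aj bi − bj ai), which needs no truncated subtraction.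
cross-term-≤ : ∀ i r bi aj bj ai → bj * ai ≤ aj * bi →
  i * bi * aj + (i + r) * bj * ai ≤ i * ai * bj + (i + r) * aj * bi
cross-term-≤ i r bi aj bj ai ba≤ab = begin
  i * bi * aj + (i + r) * bj * ai             ≡⟨ expand i r bi aj bj ai ⟩
  (i * (aj * bi) + i * (bj * ai)) + r * (bj * ai)
    ≤⟨ +-mono-≤ (≤-reflexive (+-comm (i * (aj * bi)) _)) (*-monoʳ-≤ r ba≤ab) ⟩
  (i * (bj * ai) + i * (aj * bi)) + r * (aj * bi) ≡⟨ collect i r bi aj bj ai ⟩
  i * ai * bj + (i + r) * aj * bi             ∎
  where
  open ≤-Reasoning
  expand : ∀ i r bi aj bj ai →
    i * bi * aj + (i + r) * bj * ai ≡ (i * (aj * bi) + i * (bj * ai)) + r * (bj * ai)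
  expand = solve-∀
  collect : ∀ i r bi aj bj ai →
    (i * (bj * ai) + i * (aj * bi)) + r * (aj * bi) ≡ i * ai * bj + (i + r) * aj * bi
  collect = solve-∀

module AverageComparison (a b : ℕ → ℕ) (k : ℕ)
  (ratio-≤ : ∀ l → b (suc l) * a l ≤ b l * a (suc l))
  (b-pos : ∀ l → l < k → 0 < b l) where

  ratio-≤-far : ∀ i j → i < j → j ≤ k → b j * a i ≤ a j * b i
  ratio-≤-far i (suc j) i<1+j 1+j≤k with m≤n⇒m<n∨m≡n (≤-pred i<1+j)
  ... | inj₂ refl = ≤-trans (ratio-≤ i) (≤-reflexive (*-comm (b i) (a (suc i))))
  ... | inj₁ i<j  = *-cancelˡ-≤ (b j) {{>-nonZero (b-pos j 1+j≤k)}} (begin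
    b j * (b (suc j) * a i)  ≡⟨ swap (b j) (b (suc j)) (a i) ⟩
    b (suc j) * (b j * a i)  ≤⟨ *-monoʳ-≤ (b (suc j)) (ratio-≤-far i j i<j (<⇒≤ 1+j≤k)) ⟩
    b (suc j) * (a j * b i)  ≡⟨ *-assoc (b (suc j)) (a j) (b i) ⟨
    b (suc j) * a j * b i    ≤⟨ *-monoˡ-≤ (b i) (ratio-≤ j) ⟩
    b j * a (suc j) * b i    ≡⟨ *-assoc (b j) (a (suc j)) (b i) ⟩
    b j * (a (suc j) * b i)  ∎)
    where
    open ≤-Reasoning
    swap : ∀ x y z → x * (y * z) ≡ y * (x * z)
    swap = solve-∀

  Sᵃ Sᵇ Mᵃ Mᵇ : ℕ → ℕ
  Sᵃ j = sumBelow j (λ i → i * a i)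
  Sᵇ j = sumBelow j (λ i → i * b i)
  Mᵃ j = sumBelow j a
  Mᵇ j = sumBelow j b

  -- L j ≤ R j is the cross-multiplied form of (b-average below j) ≤ (a-average below j).
  L R X Y : ℕ → ℕ
  L j = Sᵇ j * Mᵃ j
  R j = Sᵃ j * Mᵇ j
  X j = Sᵇ j * a j + j * b j * Mᵃ j
  Y j = Sᵃ j * b j + j * a j * Mᵇ j

  L-suc : ∀ j → L (suc j) ≡ L j + X j + j * b j * a j
  L-suc j = expand (Sᵇ j) (Mᵃ j) j (b j) (a j)
    where
    expand : ∀ S M j x y → (S + j * x) * (M + y) ≡ S * M + (S * y + j * x * M) + j * x * y
    expand = solve-∀

  R-suc : ∀ j → R (suc j) ≡ R j + Y j + j * b j * a j
  R-suc j = expand (Sᵃ j) (Mᵇ j) j (a j) (b j)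
    where
    expand : ∀ S M j x y → (S + j * x) * (M + y) ≡ S * M + (S * y + j * x * M) + j * y * x
    expand = solve-∀

  X≤Y : ∀ j → j ≤ k → X j ≤ Y j
  X≤Y j j≤k = begin
    Sᵇ j * a j + j * b j * Mᵃ j
      ≡⟨ cong₂ _+_ (sumBelow-*ʳ j (λ i → i * b i) (a j)) (sumBelow-*ˡ j a (j * b j)) ⟩
    sumBelow j (λ i → i * b i * a j) + sumBelow j (λ i → j * b j * a i)
      ≡⟨ sumBelow-+ j _ _ ⟨
    sumBelow j (λ i → i * b i * a j + j * b j * a i)
      ≤⟨ sumBelow-mono-≤ j pair-≤ ⟩
    sumBelow j (λ i → i * a i * b j + j * a j * b i)
      ≡⟨ sumBelow-+ j _ _ ⟩
    sumBelow j (λ i → i * a i * b j) + sumBelow j (λ i → j * a j * b i)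
      ≡⟨ cong₂ _+_ (sumBelow-*ʳ j (λ i → i * a i) (b j)) (sumBelow-*ˡ j b (j * a j)) ⟨
    Sᵃ j * b j + j * a j * Mᵇ j ∎
    where
    open ≤-Reasoning
    pair-≤ : ∀ i → i < j → i * b i * a j + j * b j * a i ≤ i * a i * b j + j * a j * b i
    pair-≤ i i<j = subst (λ j → i * b i * a j + j * b j * a i ≤ i * a i * b j + j * a j * b i)
      (m+[n∸m]≡n (<⇒≤ i<j))
      (cross-term-≤ i (j ∸ i) (b i) (a (i + (j ∸ i))) (b (i + (j ∸ i))) (a i)
        (subst (λ j → b j * a i ≤ a j * b i) (sym (m+[n∸m]≡n (<⇒≤ i<j))) (ratio-≤-far i j i<j j≤k)))

  L≤R : ∀ j → j ≤ suc k → L j ≤ R j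
  L≤R zero    _       = z≤n
  L≤R (suc j) (s≤s j≤k) = begin
    L (suc j)                  ≡⟨ L-suc j ⟩
    L j + X j + j * b j * a j
      ≤⟨ +-monoˡ-≤ (j * b j * a j) (+-mono-≤ (L≤R j (m≤n⇒m≤1+n j≤k)) (X≤Y j j≤k)) ⟩
    R j + Y j + j * b j * a j  ≡⟨ R-suc j ⟨
    R (suc j)                  ∎
    where open ≤-Reasoning

  L<R : b 1 * a 0 < a 1 * b 0 → ∀ j → 2 + j ≤ suc k → L (2 + j) < R (2 + j)
  L<R first-< zero _ = begin-strict
    L 2                        ≡⟨ L-suc 1 ⟩
    L 1 + X 1 + 1 * b 1 * a 1  ≡⟨ cong (λ x → x * a 0 + 1 * b 1 * a 1) (+-identityʳ (b 1)) ⟩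
    b 1 * a 0 + 1 * b 1 * a 1  <⟨ +-monoˡ-< (1 * b 1 * a 1) first-< ⟩
    a 1 * b 0 + 1 * b 1 * a 1  ≡⟨ cong (λ x → x * b 0 + 1 * b 1 * a 1) (+-identityʳ (a 1)) ⟨
    R 1 + Y 1 + 1 * b 1 * a 1  ≡⟨ R-suc 1 ⟨
    R 2                        ∎
    where open ≤-Reasoning
  L<R first-< (suc j) (s≤s 2+j≤k) = begin-strict
    L (3 + j)                                  ≡⟨ L-suc (2 + j) ⟩
    L (2 + j) + X (2 + j) + (2 + j) * b (2 + j) * a (2 + j)
      <⟨ +-monoˡ-< ((2 + j) * b (2 + j) * a (2 + j))
           (+-mono-<-≤ (L<R first-< j (m≤n⇒m≤1+n 2+j≤k)) (X≤Y (2 + j) 2+j≤k)) ⟩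
    R (2 + j) + Y (2 + j) + (2 + j) * b (2 + j) * a (2 + j)  ≡⟨ R-suc (2 + j) ⟨
    R (3 + j)                                  ∎
    where open ≤-Reasoning

fraction-≤ : ∀ p c q d → p * suc d ≤ q * suc c → (ℤ+ p) / suc c ≤ℚ (ℤ+ q) / suc d
fraction-≤ p c q d pd≤qc = ℚ.toℚᵘ-cancel-≤ (begin
  toℚᵘ ((ℤ+ p) / suc c)  ≃⟨ ℚ.toℚᵘ-fromℚᵘ (mkℚᵘ (ℤ+ p) c) ⟩
  mkℚᵘ (ℤ+ p) c
    ≤⟨ *≤* (subst₂ _≤ℤ_ (ℤ.pos-* p (suc d)) (ℤ.pos-* q (suc c)) (+≤+ pd≤qc)) ⟩
  mkℚᵘ (ℤ+ q) d            ≃⟨ ℚ.toℚᵘ-fromℚᵘ (mkℚᵘ (ℤ+ q) d) ⟨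
  toℚᵘ ((ℤ+ q) / suc d)  ∎)
  where open ℚᵘ.≤-Reasoning

fraction-≡ : ∀ p c q d → (ℤ+ p) / suc c ≡ (ℤ+ q) / suc d → p * suc d ≡ q * suc c
fraction-≡ p c q d p/c≡q/d with ℚ./-injective-≃ (mkℚᵘ (ℤ+ p) c) (mkℚᵘ (ℤ+ q) d) p/c≡q/d
... | *≡* pd≡qc = ℤ.+-injective (trans (ℤ.pos-* p (suc d)) (trans pd≡qc (sym (ℤ.pos-* q (suc c)))))

-- Matchings in a list of edges

Edge : ℕ → Set
Edge n = Fin n × Fin n

private variable
  n : ℕ

≠ᵇ-sym : ∀ (a b : Fin n) → (a ≠ᵇ b) ≡ (b ≠ᵇ a)
≠ᵇ-sym = adj-sym (K _)

≠ᵇ-irrefl : ∀ (a : Fin n) → (a ≠ᵇ a) ≡ false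
≠ᵇ-irrefl = adj-irrefl (K _)

disjoint-irrefl : ∀ (e : Edge n) → disjoint e e ≡ false
disjoint-irrefl (a , b) rewrite ≠ᵇ-irrefl a = refl

disjoint-sym : ∀ (e f : Edge n) → disjoint e f ≡ disjoint f e
disjoint-sym (a , b) (c , d)
  rewrite ≠ᵇ-sym c a | ≠ᵇ-sym c b | ≠ᵇ-sym d a | ≠ᵇ-sym d b
  with a ≠ᵇ c | a ≠ᵇ d
... | true  | true  = refl
... | true  | false = sym (∧-zeroʳ _)
... | false | _     = refl

matchingsIn : List (Edge n) → List (List (Edge n))
matchingsIn L = filterᵇ isMatching (sublists L)

ofSize : ℕ → List (List A) → List (List A)
ofSize l = filterᵇ (λ s → length s ≡ᵇ l)

numMatchings : ℕ → List (Edge n) → ℕ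
numMatchings l L = length (ofSize l (matchingsIn L))

freeEdges : List (Edge n) → List (Edge n) → List (Edge n)
freeEdges L t = filterᵇ (λ e → all (disjoint e) t) L

matchingsIn-∷ : ∀ (x : Edge n) F →
  matchingsIn (x ∷ F) ≡ map (x ∷_) (matchingsIn (filterᵇ (disjoint x) F)) ++ matchingsIn F
matchingsIn-∷ x F = begin
  filterᵇ isMatching (map (x ∷_) subs ++ subs)
    ≡⟨ filterᵇ-++ isMatching (map (x ∷_) subs) subs ⟩
  filterᵇ isMatching (map (x ∷_) subs) ++ matchingsIn F
    ≡⟨ cong (_++ matchingsIn F) (filterᵇ-map isMatching (x ∷_) subs) ⟩
  map (x ∷_) (filterᵇ (λ s → all (disjoint x) s ∧ isMatching s) subs) ++ matchingsIn F
    ≡⟨ cong (λ ys → map (x ∷_) ys ++ matchingsIn F) (begin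
         filterᵇ (λ s → all (disjoint x) s ∧ isMatching s) subs
           ≡⟨ filterᵇ-filterᵇ isMatching (all (disjoint x)) subs ⟨
         filterᵇ isMatching (filterᵇ (all (disjoint x)) subs)
           ≡⟨ cong (filterᵇ isMatching) (sublists-filterᵇ (disjoint x) F) ⟩
         matchingsIn (filterᵇ (disjoint x) F) ∎) ⟩
  map (x ∷_) (matchingsIn (filterᵇ (disjoint x) F)) ++ matchingsIn F ∎
  where
  open ≡-Reasoning
  subs = sublists F

ofSize-zero-map-∷ : ∀ (x : A) ss → ofSize 0 (map (x ∷_) ss) ≡ []
ofSize-zero-map-∷ x []       = refl
ofSize-zero-map-∷ x (_ ∷ ss) = ofSize-zero-map-∷ x ss

ofSize-suc-map-∷ : ∀ l (x : A) ss → ofSize (suc l) (map (x ∷_) ss) ≡ map (x ∷_) (ofSize l ss)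
ofSize-suc-map-∷ l x = filterᵇ-map (λ s → length s ≡ᵇ suc l) (x ∷_)

ofSize-zero-matchingsIn : ∀ (L : List (Edge n)) → ofSize 0 (matchingsIn L) ≡ [ [] ]
ofSize-zero-matchingsIn [] = refl
ofSize-zero-matchingsIn (x ∷ F) = begin
  ofSize 0 (matchingsIn (x ∷ F))
    ≡⟨ cong (ofSize 0) (matchingsIn-∷ x F) ⟩
  ofSize 0 (map (x ∷_) (matchingsIn F′) ++ matchingsIn F)
    ≡⟨ filterᵇ-++ _ (map (x ∷_) (matchingsIn F′)) (matchingsIn F) ⟩
  ofSize 0 (map (x ∷_) (matchingsIn F′)) ++ ofSize 0 (matchingsIn F)
    ≡⟨ cong₂ _++_ (ofSize-zero-map-∷ x (matchingsIn F′)) (ofSize-zero-matchingsIn F) ⟩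
  [ [] ] ∎
  where
  open ≡-Reasoning
  F′ = filterᵇ (disjoint x) F

ofSize-suc-matchingsIn-∷ : ∀ l (x : Edge n) F →
  ofSize (suc l) (matchingsIn (x ∷ F)) ≡
  map (x ∷_) (ofSize l (matchingsIn (filterᵇ (disjoint x) F))) ++ ofSize (suc l) (matchingsIn F)
ofSize-suc-matchingsIn-∷ l x F = begin
  ofSize (suc l) (matchingsIn (x ∷ F))
    ≡⟨ cong (ofSize (suc l)) (matchingsIn-∷ x F) ⟩
  ofSize (suc l) (map (x ∷_) (matchingsIn F′) ++ matchingsIn F)
    ≡⟨ filterᵇ-++ _ (map (x ∷_) (matchingsIn F′)) (matchingsIn F) ⟩
  ofSize (suc l) (map (x ∷_) (matchingsIn F′)) ++ ofSize (suc l) (matchingsIn F)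
    ≡⟨ cong (_++ ofSize (suc l) (matchingsIn F)) (ofSize-suc-map-∷ l x (matchingsIn F′)) ⟩
  map (x ∷_) (ofSize l (matchingsIn F′)) ++ ofSize (suc l) (matchingsIn F) ∎
  where
  open ≡-Reasoning
  F′ = filterᵇ (disjoint x) F

numMatchings-suc-∷ : ∀ l (x : Edge n) F →
  numMatchings (suc l) (x ∷ F) ≡ numMatchings l (filterᵇ (disjoint x) F) + numMatchings (suc l) F
numMatchings-suc-∷ l x F = begin
  length (ofSize (suc l) (matchingsIn (x ∷ F)))
    ≡⟨ cong length (ofSize-suc-matchingsIn-∷ l x F) ⟩
  length (map (x ∷_) (ofSize l (matchingsIn F′)) ++ ofSize (suc l) (matchingsIn F))
    ≡⟨ length-++ (map (x ∷_) (ofSize l (matchingsIn F′))) ⟩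
  length (map (x ∷_) (ofSize l (matchingsIn F′))) + numMatchings (suc l) F
    ≡⟨ cong (_+ numMatchings (suc l) F) (length-map (x ∷_) (ofSize l (matchingsIn F′))) ⟩
  numMatchings l F′ + numMatchings (suc l) F ∎
  where
  open ≡-Reasoning
  F′ = filterᵇ (disjoint x) F

numMatchings-zero : ∀ (L : List (Edge n)) → numMatchings 0 L ≡ 1
numMatchings-zero L = cong length (ofSize-zero-matchingsIn L)

numMatchings-one : ∀ (L : List (Edge n)) → numMatchings 1 L ≡ length L
numMatchings-one [] = refl
numMatchings-one (x ∷ F) = trans (numMatchings-suc-∷ 0 x F)
  (cong₂ _+_ (numMatchings-zero (filterᵇ (disjoint x) F)) (numMatchings-one F))

FreeEdgeCount : List (Edge n) → ℕ → Set
FreeEdgeCount L l =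
  sum (map (length ∘ freeEdges L) (ofSize l (matchingsIn L))) ≡ suc l * numMatchings (suc l) L

length-freeEdges-∷ : ∀ (x : Edge n) F t →
  length (freeEdges (x ∷ F) t) ≡ bool→ℕ (all (disjoint x) t) + length (freeEdges F t)
length-freeEdges-∷ x F t = length-filterᵇ-∷ (λ e → all (disjoint e) t) x F

length-freeEdges-∷-∷ : ∀ (x : Edge n) F t →
  length (freeEdges (x ∷ F) (x ∷ t)) ≡ length (freeEdges (filterᵇ (disjoint x) F) t)
length-freeEdges-∷-∷ x F t = begin
  length (freeEdges (x ∷ F) (x ∷ t))
    ≡⟨ length-freeEdges-∷ x F (x ∷ t) ⟩
  bool→ℕ (disjoint x x ∧ all (disjoint x) t) + length (freeEdges F (x ∷ t))
    ≡⟨ cong (λ b → bool→ℕ (b ∧ all (disjoint x) t) + length (freeEdges F (x ∷ t)))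
            (disjoint-irrefl x) ⟩
  length (filterᵇ (λ e → disjoint e x ∧ all (disjoint e) t) F)
    ≡⟨ cong length (filterᵇ-cong (λ e → cong (_∧ all (disjoint e) t) (disjoint-sym e x)) F) ⟩
  length (filterᵇ (λ e → disjoint x e ∧ all (disjoint e) t) F)
    ≡⟨ cong length (filterᵇ-filterᵇ (λ e → all (disjoint e) t) (disjoint x) F) ⟨
  length (freeEdges (filterᵇ (disjoint x) F) t) ∎
  where open ≡-Reasoning

ofSize-matchingsIn-avoiding : ∀ l (x : Edge n) F →
  filterᵇ (all (disjoint x)) (ofSize l (matchingsIn F)) ≡ ofSize l (matchingsIn (filterᵇ (disjoint x) F))
ofSize-matchingsIn-avoiding l x F = begin
  filterᵇ (all (disjoint x)) (ofSize l (filterᵇ isMatching (sublists F)))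
    ≡⟨ filterᵇ-comm (all (disjoint x)) _ (filterᵇ isMatching (sublists F)) ⟩
  ofSize l (filterᵇ (all (disjoint x)) (filterᵇ isMatching (sublists F)))
    ≡⟨ cong (ofSize l) (filterᵇ-comm (all (disjoint x)) isMatching (sublists F)) ⟩
  ofSize l (filterᵇ isMatching (filterᵇ (all (disjoint x)) (sublists F)))
    ≡⟨ cong (ofSize l ∘ filterᵇ isMatching) (sublists-filterᵇ (disjoint x) F) ⟩
  ofSize l (matchingsIn (filterᵇ (disjoint x) F)) ∎
  where open ≡-Reasoning

freeEdgeCount-zero : ∀ (L : List (Edge n)) → FreeEdgeCount L 0
freeEdgeCount-zero L = begin
  sum (map (length ∘ freeEdges L) (ofSize 0 (matchingsIn L)))
    ≡⟨ cong (sum ∘ map (length ∘ freeEdges L)) (ofSize-zero-matchingsIn L) ⟩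
  length (filterᵇ (λ _ → true) L) + 0
    ≡⟨ cong (λ ys → length ys + 0) (filterᵇ-const-true L) ⟩
  length L + 0
    ≡⟨ cong (_+ 0) (numMatchings-one L) ⟨
  1 * numMatchings 1 L ∎
  where open ≡-Reasoning

freeEdgeCount-∷ : ∀ l (x : Edge n) F →
  FreeEdgeCount (filterᵇ (disjoint x) F) l → FreeEdgeCount F (suc l) →
  FreeEdgeCount (x ∷ F) (suc l)
freeEdgeCount-∷ l x F count′ count = begin
  sum (map f (ofSize (suc l) (matchingsIn (x ∷ F))))
    ≡⟨ cong (sum ∘ map f) (ofSize-suc-matchingsIn-∷ l x F) ⟩
  sum (map f (map (x ∷_) ts′ ++ ts))
    ≡⟨ sum-map-++ f (map (x ∷_) ts′) ts ⟩
  sum (map f (map (x ∷_) ts′)) + sum (map f ts)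
    ≡⟨ cong₂ _+_ (trans (sum-map-∘ f (x ∷_) ts′)
                        (cong sum (map-cong (length-freeEdges-∷-∷ x F) ts′)))
                 (cong sum (map-cong (length-freeEdges-∷ x F) ts)) ⟩
  sum (map (length ∘ freeEdges F′) ts′)
    + sum (map (λ t → bool→ℕ (all (disjoint x) t) + length (freeEdges F t)) ts)
    ≡⟨ cong₂ _+_ count′ (sum-map-+ (bool→ℕ ∘ all (disjoint x)) (length ∘ freeEdges F) ts) ⟩
  suc l * a + (sum (map (bool→ℕ ∘ all (disjoint x)) ts) + sum (map (length ∘ freeEdges F) ts))
    ≡⟨ cong₂ (λ u v → suc l * a + (u + v))
             (trans (sum-map-bool→ℕ (all (disjoint x)) ts)
                    (cong length (ofSize-matchingsIn-avoiding (suc l) x F)))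
             count ⟩
  suc l * a + (a + suc (suc l) * b)
    ≡⟨ regroup (suc l) a b ⟩
  suc (suc l) * (a + b)
    ≡⟨ cong (suc (suc l) *_) (numMatchings-suc-∷ (suc l) x F) ⟨
  suc (suc l) * numMatchings (suc (suc l)) (x ∷ F) ∎
  where
  open ≡-Reasoning
  F′ = filterᵇ (disjoint x) F
  f = length ∘ freeEdges (x ∷ F)
  ts′ = ofSize l (matchingsIn F′)
  ts = ofSize (suc l) (matchingsIn F)
  a = numMatchings (suc l) F′
  b = numMatchings (suc (suc l)) F
  regroup : ∀ l a b → l * a + (a + suc l * b) ≡ suc l * (a + b)
  regroup = solve-∀

-- Generalised over a filter so that the recursive call on the edges disjoint from x is structural.
freeEdgeCount-filterᵇ : ∀ (q : Edge n → Bool) E l → FreeEdgeCount (filterᵇ q E) l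
freeEdgeCount-filterᵇ q E zero = freeEdgeCount-zero (filterᵇ q E)
freeEdgeCount-filterᵇ q [] (suc l) = sym (*-zeroʳ (suc (suc l)))
freeEdgeCount-filterᵇ q (x ∷ E) (suc l) with q x
... | false = freeEdgeCount-filterᵇ q E (suc l)
... | true  = freeEdgeCount-∷ l x (filterᵇ q E)
  (subst (λ L → FreeEdgeCount L l) (sym (filterᵇ-filterᵇ (disjoint x) q E))
         (freeEdgeCount-filterᵇ (λ e → q e ∧ disjoint x e) E l))
  (freeEdgeCount-filterᵇ q E (suc l))

freeEdgeCount : ∀ (L : List (Edge n)) l → FreeEdgeCount L l
freeEdgeCount L l = subst (λ L → FreeEdgeCount L l) (filterᵇ-const-true L)
  (freeEdgeCount-filterᵇ (λ _ → true) L l)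

∑ : ∀ n → (Fin n → ℕ) → ℕ
∑ zero    f = 0
∑ (suc n) f = f zero + ∑ n (f ∘ suc)

count : ∀ n → (Fin n → Bool) → ℕ
count n P = ∑ n (bool→ℕ ∘ P)

∑-cong : ∀ n {f g : Fin n → ℕ} → (∀ i → f i ≡ g i) → ∑ n f ≡ ∑ n g
∑-cong zero    f≗g = refl
∑-cong (suc n) f≗g = cong₂ _+_ (f≗g zero) (∑-cong n (f≗g ∘ suc))

∑-mono-≤ : ∀ n {f g : Fin n → ℕ} → (∀ i → f i ≤ g i) → ∑ n f ≤ ∑ n g
∑-mono-≤ zero    f≤g = z≤n
∑-mono-≤ (suc n) f≤g = +-mono-≤ (f≤g zero) (∑-mono-≤ n (f≤g ∘ suc))

∑-mono-< : ∀ n {f g : Fin n → ℕ} → (∀ i → f i ≤ g i) → ∀ j → f j < g j → ∑ n f < ∑ n g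
∑-mono-< (suc n) f≤g zero    fj<gj = +-mono-<-≤ fj<gj (∑-mono-≤ n (f≤g ∘ suc))
∑-mono-< (suc n) f≤g (suc j) fj<gj = +-mono-≤-< (f≤g zero) (∑-mono-< n (f≤g ∘ suc) j fj<gj)

bool→ℕ-mono : ∀ {p q} → (T p → T q) → bool→ℕ p ≤ bool→ℕ q
bool→ℕ-mono {false}         _   = z≤n
bool→ℕ-mono {true}  {true}  _   = ≤-refl
bool→ℕ-mono {true}  {false} p⇒q with () ← p⇒q _

count-cong : ∀ n {P Q : Fin n → Bool} → (∀ i → P i ≡ Q i) → count n P ≡ count n Q
count-cong n P≗Q = ∑-cong n (cong bool→ℕ ∘ P≗Q)

count-mono-≤ : ∀ n {P Q : Fin n → Bool} → (∀ i → T (P i) → T (Q i)) → count n P ≤ count n Q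
count-mono-≤ n P⇒Q = ∑-mono-≤ n (bool→ℕ-mono ∘ P⇒Q)

count-mono-< : ∀ n {P Q : Fin n → Bool} → (∀ i → T (P i) → T (Q i)) →
  ∀ j → P j ≡ false → Q j ≡ true → count n P < count n Q
count-mono-< n P⇒Q j Pj Qj = ∑-mono-< n (bool→ℕ-mono ∘ P⇒Q) j
  (subst₂ (λ p q → bool→ℕ p < bool→ℕ q) (sym Pj) (sym Qj) ≤-refl)

count-true : ∀ n → count n (λ _ → true) ≡ n
count-true zero    = refl
count-true (suc n) = cong suc (count-true n)

count-∧ˡ : ∀ n c (P : Fin n → Bool) → count n (λ i → c ∧ P i) ≡ bool→ℕ c * count n P
count-∧ˡ n       true  P = sym (+-identityʳ _)
count-∧ˡ zero    false P = refl
count-∧ˡ (suc n) false P = count-∧ˡ n false (P ∘ suc)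

count-delete : ∀ n (c : Fin n) (W : Fin n → Bool) → T (W c) →
  count n (λ v → (v ≠ᵇ c) ∧ W v) + 1 ≡ count n W
count-delete (suc n) zero    W Wc with W zero
... | true = +-comm _ 1
count-delete (suc n) (suc c) W Wc = begin
  bool→ℕ (W zero) + count n (λ v → (suc v ≠ᵇ suc c) ∧ W (suc v)) + 1
    ≡⟨ +-assoc (bool→ℕ (W zero)) _ 1 ⟩
  bool→ℕ (W zero) + (count n (λ v → (suc v ≠ᵇ suc c) ∧ W (suc v)) + 1)
    ≡⟨ cong (λ k → bool→ℕ (W zero) + (k + 1))
            (count-cong n (λ v → cong (_∧ W (suc v)) (≠ᵇ-suc v c))) ⟩
  bool→ℕ (W zero) + (count n (λ v → (v ≠ᵇ c) ∧ W (suc v)) + 1)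
    ≡⟨ cong (bool→ℕ (W zero) +_) (count-delete n c (W ∘ suc) Wc) ⟩
  count (suc n) W ∎
  where
  open ≡-Reasoning
  ≠ᵇ-suc : ∀ (i j : Fin n) → (suc i ≠ᵇ suc j) ≡ (i ≠ᵇ j)
  ≠ᵇ-suc i j with i ≟ j
  ... | yes _ = refl
  ... | no  _ = refl

pairs : ∀ n → List (Edge n)
pairs n = cartesianProduct (allFin n) (allFin n)

length-filterᵇ-tabulate : ∀ n (p : A → Bool) (f : Fin n → A) →
  length (filterᵇ p (tabulate f)) ≡ count n (p ∘ f)
length-filterᵇ-tabulate zero    p f = refl
length-filterᵇ-tabulate (suc n) p f =
  trans (length-filterᵇ-∷ p (f zero) (tabulate (f ∘ suc)))
        (cong (bool→ℕ (p (f zero)) +_) (length-filterᵇ-tabulate n p (f ∘ suc)))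

length-filterᵇ-cartesianProduct : ∀ n (p : A × B → Bool) (f : Fin n → A) ys →
  length (filterᵇ p (cartesianProduct (tabulate f) ys)) ≡
  ∑ n (λ i → length (filterᵇ (λ y → p (f i , y)) ys))
length-filterᵇ-cartesianProduct zero    p f ys = refl
length-filterᵇ-cartesianProduct (suc n) p f ys = begin
  length (filterᵇ p (map (f zero ,_) ys ++ rest))
    ≡⟨ cong length (filterᵇ-++ p (map (f zero ,_) ys) rest) ⟩
  length (filterᵇ p (map (f zero ,_) ys) ++ filterᵇ p rest)
    ≡⟨ length-++ (filterᵇ p (map (f zero ,_) ys)) ⟩
  length (filterᵇ p (map (f zero ,_) ys)) + length (filterᵇ p rest)
    ≡⟨ cong₂ _+_ (trans (cong length (filterᵇ-map p (f zero ,_) ys))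
                        (length-map (f zero ,_) (filterᵇ (λ y → p (f zero , y)) ys)))
                 (length-filterᵇ-cartesianProduct n p (f ∘ suc) ys) ⟩
  ∑ (suc n) (λ i → length (filterᵇ (λ y → p (f i , y)) ys)) ∎
  where
  open ≡-Reasoning
  rest = cartesianProduct (tabulate (f ∘ suc)) ys

length-filterᵇ-pairs : ∀ n (p : Edge n → Bool) →
  length (filterᵇ p (pairs n)) ≡ ∑ n (λ i → count n (λ j → p (i , j)))
length-filterᵇ-pairs n p = trans (length-filterᵇ-cartesianProduct n p id (allFin n))
  (∑-cong n (λ i → length-filterᵇ-tabulate n (λ j → p (i , j)) id))

count-increasing-pairs : ∀ n (U : Fin n → Bool) →
  ∑ n (λ a → count n (λ b → (toℕ a <ᵇ toℕ b) ∧ (U a ∧ U b))) ≡ count n U C 2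
count-increasing-pairs zero    U = refl
count-increasing-pairs (suc n) U = begin
  count n (λ b → U zero ∧ U (suc b))
    + ∑ n (λ a → count n (λ b → (toℕ a <ᵇ toℕ b) ∧ (U (suc a) ∧ U (suc b))))
    ≡⟨ cong₂ _+_ (count-∧ˡ n (U zero) (U ∘ suc)) (count-increasing-pairs n (U ∘ suc)) ⟩
  bool→ℕ (U zero) * c + c C 2
    ≡⟨ add-vertex (U zero) ⟩
  (bool→ℕ (U zero) + c) C 2 ∎
  where
  open ≡-Reasoning
  c = count n (U ∘ suc)
  add-vertex : ∀ u → bool→ℕ u * c + c C 2 ≡ (bool→ℕ u + c) C 2
  add-vertex false = refl
  add-vertex true  = trans (cong (λ k → k + c C 2) (trans (+-identityʳ c) (sym (nC1≡n c))))
                           (nCk+nC[k+1]≡[n+1]C[k+1] c 1)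

-- Free edges in K_n and in an arbitrary graph

isEdgeOf : Graph n → Edge n → Bool
isEdgeOf G (a , b) = (toℕ a <ᵇ toℕ b) ∧ adj G a b

<ᵇ⇒≢ : ∀ (a b : Fin n) → T (toℕ a <ᵇ toℕ b) → a ≢ b
<ᵇ⇒≢ a .a a<a refl = <-irrefl refl (<ᵇ⇒< (toℕ a) (toℕ a) a<a)

≢⇒≠ᵇ : ∀ {a b : Fin n} → a ≢ b → (a ≠ᵇ b) ≡ true
≢⇒≠ᵇ {a = a} {b} a≢b with a ≟ b
... | yes a≡b = contradiction a≡b a≢b
... | no  _   = refl

isEdgeOf-K : ∀ (e : Edge n) → isEdgeOf (K n) e ≡ (toℕ (proj₁ e) <ᵇ toℕ (proj₂ e))
isEdgeOf-K (a , b) with toℕ a <ᵇ toℕ b in a<b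
... | true  = ≢⇒≠ᵇ (<ᵇ⇒≢ a b (Equivalence.from T-≡ a<b))
... | false = refl

isEdgeOf⇒isEdgeOf-K : ∀ (G : Graph n) e → T (isEdgeOf G e) → T (isEdgeOf (K n) e)
isEdgeOf⇒isEdgeOf-K G e@(a , b) a<b∧ab rewrite isEdgeOf-K e = proj₁ (Equivalence.to T-∧ a<b∧ab)

avoids : Fin n → Edge n → Bool
avoids v (a , b) = (v ≠ᵇ a) ∧ (v ≠ᵇ b)

uncovered : List (Edge n) → Fin n → Bool
uncovered t v = all (avoids v) t

all-disjoint : ∀ (a b : Fin n) t → all (disjoint (a , b)) t ≡ uncovered t a ∧ uncovered t b
all-disjoint a b [] = refl
all-disjoint a b ((c , d) ∷ t) rewrite all-disjoint a b t
  with a ≠ᵇ c | a ≠ᵇ d | uncovered t a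
... | false | _     | _     = refl
... | true  | false | _     = refl
... | true  | true  | true  = refl
... | true  | true  | false = ∧-zeroʳ _

count-uncovered : ∀ {n} (t : List (Edge n)) → T (isMatching t) → All (T ∘ isEdgeOf (K n)) t →
  count n (uncovered t) + 2 * length t ≡ n
count-uncovered []            _     _               = trans (+-identityʳ _) (count-true _)
count-uncovered {n} ((c , d) ∷ t) match (c<d ∷ t-edges) = begin
  count n (uncovered ((c , d) ∷ t)) + 2 * suc (length t)
    ≡⟨ regroup (count n (uncovered ((c , d) ∷ t))) (length t) ⟩
  count n (uncovered ((c , d) ∷ t)) + 1 + 1 + 2 * length t
    ≡⟨ cong (λ k → k + 1 + 1 + 2 * length t)
            (count-cong n (λ v → ∧-assoc (v ≠ᵇ c) (v ≠ᵇ d) (uncovered t v))) ⟩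
  count n (λ v → (v ≠ᵇ c) ∧ W v) + 1 + 1 + 2 * length t
    ≡⟨ cong (λ k → k + 1 + 2 * length t) (count-delete n c W Wc) ⟩
  count n W + 1 + 2 * length t
    ≡⟨ cong (_+ 2 * length t) (count-delete n d (uncovered t) Ud) ⟩
  count n (uncovered t) + 2 * length t
    ≡⟨ count-uncovered t match-t t-edges ⟩
  n ∎
  where
  open ≡-Reasoning
  W : Fin n → Bool
  W v = (v ≠ᵇ d) ∧ uncovered t v
  split = Equivalence.to T-∧ match
  match-t = proj₂ split
  Uc×Ud = Equivalence.to T-∧ (subst T (all-disjoint c d t) (proj₁ split))
  Ud = proj₂ Uc×Ud
  c≠d : (c ≠ᵇ d) ≡ true
  c≠d = ≢⇒≠ᵇ (<ᵇ⇒≢ c d (subst T (isEdgeOf-K (c , d)) c<d))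
  Wc : T (W c)
  Wc rewrite c≠d = proj₁ Uc×Ud
  regroup : ∀ x l → x + 2 * suc l ≡ x + 1 + 1 + 2 * l
  regroup = solve-∀

length-freeEdges-K : ∀ {n} (t : List (Edge n)) → length (freeEdges (edges (K n)) t) ≡ count n (uncovered t) C 2
length-freeEdges-K {n} t = begin
  length (freeEdges (filterᵇ (isEdgeOf (K n)) (pairs n)) t)
    ≡⟨ cong length (filterᵇ-filterᵇ (λ e → all (disjoint e) t) (isEdgeOf (K n)) (pairs n)) ⟩
  length (filterᵇ (λ e → isEdgeOf (K n) e ∧ all (disjoint e) t) (pairs n))
    ≡⟨ length-filterᵇ-pairs n (λ e → isEdgeOf (K n) e ∧ all (disjoint e) t) ⟩
  ∑ n (λ a → count n (λ b → isEdgeOf (K n) (a , b) ∧ all (disjoint (a , b)) t))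
    ≡⟨ ∑-cong n (λ a → count-cong n (λ b → cong₂ _∧_ (isEdgeOf-K (a , b)) (all-disjoint a b t))) ⟩
  ∑ n (λ a → count n (λ b → (toℕ a <ᵇ toℕ b) ∧ (uncovered t a ∧ uncovered t b)))
    ≡⟨ count-increasing-pairs n (uncovered t) ⟩
  count n (uncovered t) C 2 ∎
  where open ≡-Reasoning

length-freeEdges-K-matching : ∀ {n} (t : List (Edge n)) → T (isMatching t) → All (T ∘ isEdgeOf (K n)) t →
  length (freeEdges (edges (K n)) t) ≡ (n ∸ 2 * length t) C 2
length-freeEdges-K-matching {n} t match t-edges = trans (length-freeEdges-K t) (cong (_C 2) (begin
  count n (uncovered t)                         ≡⟨ m+n∸n≡m (count n (uncovered t)) (2 * length t) ⟨
  count n (uncovered t) + 2 * length t ∸ 2 * length t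
    ≡⟨ cong (_∸ 2 * length t) (count-uncovered t match t-edges) ⟩
  n ∸ 2 * length t                              ∎))
  where open ≡-Reasoning

length-freeEdges-≤-K : ∀ {n} (G : Graph n) t →
  length (freeEdges (edges G) t) ≤ length (freeEdges (edges (K n)) t)
length-freeEdges-≤-K {n} G t = subst₂ _≤_
  (cong length (sym (filterᵇ-filterᵇ (λ e → all (disjoint e) t) (isEdgeOf G) (pairs n))))
  (cong length (sym (filterᵇ-filterᵇ (λ e → all (disjoint e) t) (isEdgeOf (K n)) (pairs n))))
  (length-filterᵇ-mono edge-of-K (pairs n))
  where
  edge-of-K : ∀ e → T (isEdgeOf G e ∧ all (disjoint e) t) → T (isEdgeOf (K n) e ∧ all (disjoint e) t)
  edge-of-K e = Equivalence.from T-∧ ∘ map₁ (isEdgeOf⇒isEdgeOf-K G e) ∘ Equivalence.to T-∧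

-- Ratios of consecutive matching numbers

ofSize-matchingsIn-All : ∀ l (q : Edge n → Bool) E →
  All (λ t → length t ≡ l × T (isMatching t) × All (T ∘ q) t) (ofSize l (matchingsIn (filterᵇ q E)))
ofSize-matchingsIn-All l q E = All.zip (sized , filter⁺ (T? ∘ sizeIs) (All.zip (matching , q-edges)))
  where
  sizeIs : List (Edge _) → Bool
  sizeIs s = length s ≡ᵇ l
  sized = All.map (λ {t} → ≡ᵇ⇒≡ (length t) l) (all-filter (T? ∘ sizeIs) (matchingsIn (filterᵇ q E)))
  matching = all-filter (T? ∘ isMatching) (sublists (filterᵇ q E))
  q-edges = filter⁺ (T? ∘ isMatching) (All.map (λ {t} → all⁺ q t)
    (subst (All (T ∘ all q)) (sublists-filterᵇ q E) (all-filter (T? ∘ all q) (sublists E))))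

m-suc-≤ : ∀ {n} (G : Graph n) l → suc l * m G (suc l) ≤ m G l * ((n ∸ 2 * l) C 2)
m-suc-≤ {n} G l = begin
  suc l * m G (suc l)
    ≡⟨ freeEdgeCount (edges G) l ⟨
  sum (map (length ∘ freeEdges (edges G)) (ofSize l (matchings G)))
    ≤⟨ sum-map-≤ (length ∘ freeEdges (edges G))
                 (All.map bound (ofSize-matchingsIn-All l (isEdgeOf G) (pairs n))) ⟩
  m G l * ((n ∸ 2 * l) C 2) ∎
  where
  open ≤-Reasoning
  bound : ∀ {t} → length t ≡ l × T (isMatching t) × All (T ∘ isEdgeOf G) t →
          length (freeEdges (edges G) t) ≤ (n ∸ 2 * l) C 2
  bound {t} (refl , match , t-edges) = ≤-trans (length-freeEdges-≤-K G t)
    (≤-reflexive (length-freeEdges-K-matching t match (All.map (isEdgeOf⇒isEdgeOf-K G _) t-edges)))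

m-K-suc : ∀ n l → suc l * m (K n) (suc l) ≡ m (K n) l * ((n ∸ 2 * l) C 2)
m-K-suc n l = begin
  suc l * m (K n) (suc l)
    ≡⟨ freeEdgeCount (edges (K n)) l ⟨
  sum (map (length ∘ freeEdges (edges (K n))) (ofSize l (matchings (K n))))
    ≡⟨ sum-map-≡ (length ∘ freeEdges (edges (K n)))
                 (All.map exact (ofSize-matchingsIn-All l (isEdgeOf (K n)) (pairs n))) ⟩
  m (K n) l * ((n ∸ 2 * l) C 2) ∎
  where
  open ≡-Reasoning
  exact : ∀ {t} → length t ≡ l × T (isMatching t) × All (T ∘ isEdgeOf (K n)) t →
          length (freeEdges (edges (K n)) t) ≡ (n ∸ 2 * l) C 2
  exact {t} (refl , match , t-edges) = length-freeEdges-K-matching t match t-edges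

m-ratio-≤-K : ∀ {n} (G : Graph n) l → m G (suc l) * m (K n) l ≤ m G l * m (K n) (suc l)
m-ratio-≤-K {n} G l = *-cancelˡ-≤ (suc l) (begin
  suc l * (m G (suc l) * m (K n) l)  ≡⟨ *-assoc (suc l) (m G (suc l)) (m (K n) l) ⟨
  suc l * m G (suc l) * m (K n) l    ≤⟨ *-monoˡ-≤ (m (K n) l) (m-suc-≤ G l) ⟩
  m G l * D * m (K n) l              ≡⟨ reorder (m G l) D (m (K n) l) ⟩
  m G l * (m (K n) l * D)            ≡⟨ cong (m G l *_) (m-K-suc n l) ⟨
  m G l * (suc l * m (K n) (suc l))  ≡⟨ swap (m G l) (suc l) (m (K n) (suc l)) ⟩
  suc l * (m G l * m (K n) (suc l))  ∎)
  where
  open ≤-Reasoning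
  D = (n ∸ 2 * l) C 2
  reorder : ∀ x y z → x * y * z ≡ x * (z * y)
  reorder = solve-∀
  swap : ∀ x y z → x * (y * z) ≡ y * (x * z)
  swap = solve-∀

m-zero : ∀ {n} (G : Graph n) → m G 0 ≡ 1
m-zero G = numMatchings-zero (edges G)

missing-edge⇒length-edges-< : ∀ {n} (G : Graph n) (a b : Fin n) → toℕ a < toℕ b → adj G a b ≡ false →
  length (edges G) < length (edges (K n))
missing-edge⇒length-edges-< {n} G a b a<b ab = subst₂ _<_
  (sym (length-filterᵇ-pairs n (isEdgeOf G))) (sym (length-filterᵇ-pairs n (isEdgeOf (K n))))
  (∑-mono-< n (λ x → count-mono-≤ n (λ y → isEdgeOf⇒isEdgeOf-K G (x , y))) a
    (count-mono-< n (λ y → isEdgeOf⇒isEdgeOf-K G (a , y)) b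
      (trans (cong ((toℕ a <ᵇ toℕ b) ∧_) ab) (∧-zeroʳ _))
      (trans (isEdgeOf-K (a , b)) (Equivalence.to T-≡ (<⇒<ᵇ a<b)))))

length-edges-< : ∀ {n} (G : Graph n) (i j : Fin n) → i ≢ j → adj G i j ≡ false →
  length (edges G) < length (edges (K n))
length-edges-< G i j i≢j ij with <-cmp (toℕ i) (toℕ j)
... | tri< i<j _ _ = missing-edge⇒length-edges-< G i j i<j ij
... | tri≈ _ i≡j _ = contradiction (toℕ-injective i≡j) i≢j
... | tri> _ _ j<i = missing-edge⇒length-edges-< G j i j<i (trans (adj-sym G j i) ij)

m-suc-zero : ∀ {n} (G : Graph n) l → m G l ≡ 0 → m G (suc l) ≡ 0
m-suc-zero {n} G l m≡0 = n≤0⇒n≡0 (begin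
  m G (suc l)                  ≤⟨ m≤n*m (m G (suc l)) (suc l) ⟩
  suc l * m G (suc l)          ≤⟨ m-suc-≤ G l ⟩
  m G l * ((n ∸ 2 * l) C 2)    ≡⟨ cong (_* ((n ∸ 2 * l) C 2)) m≡0 ⟩
  0                            ∎)
  where open ≤-Reasoning

m-zero-≤′ : ∀ {n} (G : Graph n) {l j} → m G l ≡ 0 → l ≤′ j → m G j ≡ 0
m-zero-≤′ G m≡0 ≤′-refl        = m≡0
m-zero-≤′ G m≡0 (≤′-step l≤′j) = m-suc-zero G _ (m-zero-≤′ G m≡0 l≤′j)

length-<-ofSize-empty : ∀ k (ss : List (List A)) → (∀ j → k ≤ j → length (ofSize j ss) ≡ 0) →
  All (λ s → length s < k) ss
length-<-ofSize-empty k []       _    = []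
length-<-ofSize-empty k (s ∷ ss) none = s<k ∷ length-<-ofSize-empty k ss none-ss
  where
  none-ss : ∀ j → k ≤ j → length (ofSize j ss) ≡ 0
  none-ss j k≤j = m+n≡0⇒n≡0 (bool→ℕ (length s ≡ᵇ j))
    (trans (sym (length-filterᵇ-∷ (λ s → length s ≡ᵇ j) s ss)) (none j k≤j))
  s<k : length s < k
  s<k with k ≤? length s
  ... | no  k≰s = ≰⇒> k≰s
  ... | yes k≤s
    with trans (sym (length-filterᵇ-∷ (λ s′ → length s′ ≡ᵇ length s) s ss)) (none (length s) k≤s)
  ...   | counted rewrite Equivalence.to T-≡ (≡⇒≡ᵇ (length s) (length s) refl) with () ← counted

μ-< : ∀ {n} (G : Graph n) k → 0 < k → (∀ j → k ≤ j → m G j ≡ 0) → μ G < k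
μ-< G k 0<k none =
  foldr-preservesᵇ {P = _< k} {f = _⊔_} ⊔-lub 0<k (map⁺ (length-<-ofSize-empty k (matchings G) none))

m-pos : ∀ {n} (G : Graph n) l → l ≤ μ G → 0 < m G l
m-pos G zero    _   = ≤-reflexive (sym (m-zero G))
m-pos G (suc l) l≤μ with m G (suc l) in m≡0
... | suc _ = z<s
... | zero  = contradiction l≤μ
  (<⇒≱ (μ-< G (suc l) z<s (λ j l≤j → m-zero-≤′ G m≡0 (≤⇒≤′ l≤j))))

-- M G k with the term m G 0 = 1 split off, so that the denominator of av G k is visibly a successor.
M⁺ : ∀ {n} → Graph n → ℕ → ℕ
M⁺ G k = sum (map (m G) (applyUpTo suc k))

M≡suc-M⁺ : ∀ {n} (G : Graph n) k → M G k ≡ suc (M⁺ G k)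
M≡suc-M⁺ G k = cong (_+ M⁺ G k) (m-zero G)

av≡S/M : ∀ {n} (G : Graph n) k → av G k ≡ (ℤ+ S G k) / suc (M⁺ G k)
av≡S/M G k with M G k | M≡suc-M⁺ G k
... | _ | refl = refl

av-≤-cross : ∀ {n n′} (G : Graph n) (H : Graph n′) k →
  S G k * M H k ≤ S H k * M G k → av G k ≤ℚ av H k
av-≤-cross G H k cross = subst₂ _≤ℚ_ (sym (av≡S/M G k)) (sym (av≡S/M H k))
  (fraction-≤ (S G k) (M⁺ G k) (S H k) (M⁺ H k)
    (subst₂ _≤_ (cong (S G k *_) (M≡suc-M⁺ H k)) (cong (S H k *_) (M≡suc-M⁺ G k)) cross))

av-≡-cross : ∀ {n n′} (G : Graph n) (H : Graph n′) k →
  av G k ≡ av H k → S G k * M H k ≡ S H k * M G k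
av-≡-cross G H k av≡ =
  subst₂ _≡_ (cong (S G k *_) (sym (M≡suc-M⁺ H k))) (cong (S H k *_) (sym (M≡suc-M⁺ G k)))
  (fraction-≡ (S G k) (M⁺ G k) (S H k) (M⁺ H k)
    (trans (sym (av≡S/M G k)) (trans av≡ (av≡S/M H k))))

av-cong-edges : ∀ {n} (G H : Graph n) k → edges G ≡ edges H → av G k ≡ av H k
av-cong-edges G H k G≡H = trans (av≡S/M G k) (trans
  (cong (λ L → (ℤ+ sum (map (λ i → i * numMatchings i L) (upTo (suc k))))
                 / suc (sum (map (λ i → numMatchings i L) (applyUpTo suc k)))) G≡H)
  (sym (av≡S/M H k)))

complete⇒edges≡ : ∀ {n} (G : Graph n) → IsComplete G → edges G ≡ edges (K n)
complete⇒edges≡ {n} G complete = filterᵇ-cong same-edge (pairs n)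
  where
  same-edge : ∀ e → isEdgeOf G e ≡ isEdgeOf (K n) e
  same-edge (a , b) with toℕ a <ᵇ toℕ b in a<b
  ... | false = refl
  ... | true  = trans (complete a b a≢b) (sym (≢⇒≠ᵇ a≢b))
    where a≢b = <ᵇ⇒≢ a b (Equivalence.from T-≡ a<b)

module _ {n} (G : Graph n) (k : ℕ) (k≤μ : k ≤ μ G) where
  open AverageComparison (m (K n)) (m G) k (m-ratio-≤-K G)
    (λ l l<k → m-pos G l (≤-trans (<⇒≤ l<k) k≤μ))

  private
    L≡ : S G k * M (K n) k ≡ L (suc k)
    L≡ = cong₂ _*_ (sum-map-upTo (λ i → i * m G i) (suc k)) (sum-map-upTo (m (K n)) (suc k))
    R≡ : S (K n) k * M G k ≡ R (suc k)
    R≡ = cong₂ _*_ (sum-map-upTo (λ i → i * m (K n) i) (suc k)) (sum-map-upTo (m G) (suc k))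

  S-M-cross-≤ : S G k * M (K n) k ≤ S (K n) k * M G k
  S-M-cross-≤ = subst₂ _≤_ (sym L≡) (sym R≡) (L≤R (suc k) ≤-refl)

  S-M-cross-< : 0 < k → ∀ i j → i ≢ j → adj G i j ≡ false → S G k * M (K n) k < S (K n) k * M G k
  S-M-cross-< 0<k i j i≢j ij = subst₂ _<_ (sym L≡) (sym R≡)
    (subst (λ j → L j < R j) 2+[k-1]≡1+k (L<R fewer-edges (k ∸ 1) (≤-reflexive 2+[k-1]≡1+k)))
    where
    2+[k-1]≡1+k : 2 + (k ∸ 1) ≡ suc k
    2+[k-1]≡1+k = cong suc (m+[n∸m]≡n 0<k)
    fewer-edges : m G 1 * m (K n) 0 < m (K n) 1 * m G 0
    fewer-edges = subst₂ _<_
      (cong₂ _*_ (sym (numMatchings-one (edges G))) (sym (m-zero (K n))))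
      (cong₂ _*_ (sym (numMatchings-one (edges (K n)))) (sym (m-zero G)))
      (*-monoˡ-< 1 (length-edges-< G i j i≢j ij))

theorem3p7 : ∀ (n : ℕ) (G : Graph n) (k : ℕ) → 0 < k → k ≤ μ G →
    (av G k ≤ℚ av (K n) k) × ((av (K n) k ≡ av G k) ⇔ IsComplete G)
theorem3p7 n G k 0<k k≤μ =
  av-≤-cross G (K n) k (S-M-cross-≤ G k k≤μ) , mk⇔ av≡⇒complete complete⇒av≡
  where
  av≡⇒complete : av (K n) k ≡ av G k → IsComplete G
  av≡⇒complete av≡ i j i≢j with adj G i j in ij
  ... | true  = refl
  ... | false = contradiction (sym (av-≡-cross (K n) G k av≡)) (<⇒≢ (S-M-cross-< G k k≤μ 0<k i j i≢j ij))
  complete⇒av≡ : IsComplete G → av (K n) k ≡ av G k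
  complete⇒av≡ complete = sym (av-cong-edges G (K n) k (complete⇒edges≡ G complete))
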